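{- Let $\phi$ be an $\textit{LTL}_f$ formula and $\eta=\omega_0\omega_1\ldots\omega_n\in\Sigma^*$ a finite trace. Then: 1. If $n=0$, then $\eta\models\phi$ iff there exists a clause $\alpha\wedge X(\psi)\in\mathit{NF}(\phi)$ such that $\omega_0\models\alpha$ and $\omega_\alpha\models\phi$ (i.e. the length-one trace $\omega_\alpha$ satisfies $\phi$). 2. If $n\ge 1$, then $\eta\models\phi$ iff there exists a clause $\alpha\wedge X(\psi)\in\mathit{NF}(\phi)$ such that $\omega_0\models\alpha$ and $\eta_1\models\psi$. 3. $\eta\models\phi$ iff there exists a run $\phi=\phi_0\xrightarrow{\alpha_0}\phi_1\xrightarrow{\alpha_1}\phi_2\cdots\xrightarrow{\alpha_n}\phi_{n+1}$ of $T_\phi$ on $\eta$ such that for every $0\le i\le n$, $\omega_i\models\alpha_i$ and $\eta_i\models\phi_i$.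
   Context: Fix a finite set $\mathcal{P}$ of atomic propositions; $L=\mathcal{P}\cup\{\neg a: a\in\mathcal{P}\}$ is the set of literals and $\Sigma=2^{L}$. $\textit{LTL}_f$ formulas are in negation normal form: $\phi::=\mathsf{tt}\mid\mathsf{ff}\mid \ell\mid \phi\wedge\phi\mid\phi\vee\phi\mid X\phi\mid X_w\phi\mid \phi U\phi\mid\phi R\phi$, $\ell\in L$. A finite trace is $\eta=\omega_0\ldots\omega_n\in\Sigma^*$ ($n\ge0$), $|\eta|=n+1$, $\eta_i=\omega_i\ldots\omega_n$. Satisfaction: $\eta\models\mathsf{tt}$, $\eta\not\models\mathsf{ff}$; $\eta\models\ell$ iff $\ell\in\omega_0$; $\wedge,\vee$ as usual; $\eta\models X\psi$ iff $|\eta|>1$ and $\eta_1\models\psi$; $\eta\models X_w\psi$ iff $|\eta|=1$ or ($|\eta|>1$ and $\eta_1\models\psi$); $\eta\models\phi_1U\phi_2$ iff some $0\le i<|\eta|$ has $\eta_i\models\phi_2$ and $\eta_j\models\phi_1$ for all $j<i$; $\eta\models\phi_1R\phi_2$ iff either $\eta_i\models\phi_2$ for all $0\le i<|\eta|$, or some $0\le i<|\eta|$ has $\eta_i\models\phi_1$ and $\eta_j\models\phi_2$ for all $j\le i$. A letter $\omega\in\Sigma$ is identified with the length-one trace $\omega$, so $\omega\models\alpha$ is defined. For a formula $\phi$, $CF(\phi)$ is its set of conjuncts ($\phi=\bigwedge_{i\in I}\phi_i$ with no $\phi_i$ having root $\wedge$) and $DF(\phi)$ its set of disjuncts (defined analogously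 with $\vee$). Normal form $\mathit{NF}(\phi)$, a set of formulas (clauses) of the form $\alpha\wedge X(\psi)$: $\mathit{NF}(\mathsf{ff})=\emptyset$; $\mathit{NF}(\phi)=\{\phi\wedge X(\mathsf{tt})\}$ if $\phi$ is $\mathsf{tt}$ or a literal; $\mathit{NF}(X\phi)=\mathit{NF}(X_w\phi)=\{\mathsf{tt}\wedge X(\psi)\mid\psi\in DF(\phi)\}$; $\mathit{NF}(\phi_1U\phi_2)=\mathit{NF}(\phi_2)\cup\mathit{NF}(\phi_1\wedge X(\phi_1U\phi_2))$; $\mathit{NF}(\phi_1R\phi_2)=\mathit{NF}(\phi_1\wedge\phi_2)\cup\mathit{NF}(\phi_2\wedge X(\phi_1R\phi_2))$; $\mathit{NF}(\phi_1\vee\phi_2)=\mathit{NF}(\phi_1)\cup\mathit{NF}(\phi_2)$; $\mathit{NF}(\phi_1\wedge\phi_2)=\{(\alpha_1\wedge\alpha_2)\wedge X(\psi_1\wedge\psi_2)\mid \alpha_i\wedge X(\psi_i)\in\mathit{NF}(\phi_i),\ i=1,2\}$. Thus every clause label $\alpha$ is a conjunction of literals and $\mathsf{tt}$; $\omega_\alpha\in\Sigma$ denotes the set of literals among the conjuncts $CF(\alpha)$. The transition system $T_\phi$ has initial state $\phi$, transitions $\psi_1\xrightarrow{\alpha}\psi_2$ iff $\alpha\wedge X(\psi_2)\in\mathit{NF}(\psi_1)$, and state set the smallest set of formulas containing $\phi$ and closed under transitions. A run of $T_\phi$ on $\eta=\omega_0\ldots\omega_n$ is a sequence $s_0\xrightarrow{\alpha_0}s_1\xrightarrow{\alpha_1}\cdots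 s_n\xrightarrow{\alpha_n}s_{n+1}$ of transitions of $T_\phi$ with $s_0=\phi$ and $\omega_i\models\alpha_i$ for all $0\le i\le n$. -}

module Defs where

open import Data.Nat using (ℕ; zero; suc; _<_; _≤_)
open import Data.Fin using (Fin)
open import Data.List using (List; []; _∷_; _++_; map; concatMap)
open import Data.List.NonEmpty using (List⁺; _∷_; head; length)
open import Data.List.Membership.Propositional using (_∈_)
open import Data.Product using (_×_; _,_; ∃-syntax)
open import Data.Sum using (_⊎_)
open import Data.Unit using (⊤)
open import Data.Empty using (⊥)
open import Relation.Binary.PropositionalEquality using (_≡_)

Atom : ℕ → Set
Atom k = Fin k

data Lit (k : ℕ) : Set where
  pos : Atom k → Lit k
  neg : Atom k → Lit k

-- A letter ω ∈ Σ = 2^L, represented by a finite list of literals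
-- (ℓ ∈ ω is list membership).
Letter : ℕ → Set
Letter k = List (Lit k)

Trace : ℕ → Set
Trace k = List⁺ (Letter k)

-- LTLf formulas in negation normal form
data Form (k : ℕ) : Set where
  tt ff : Form k
  lit : Lit k → Form k
  _∧_ _∨_ : Form k → Form k → Form k
  X Xw : Form k → Form k
  _U_ _R_ : Form k → Form k → Form k

-- suffix ηᵢ (only meaningful for i < |η|)
sfx : ∀ {k} → Trace k → ℕ → Trace k
sfx η zero = η
sfx (x ∷ []) (suc i) = x ∷ []
sfx (x ∷ y ∷ ys) (suc i) = sfx (y ∷ ys) i

_⊨_ : ∀ {k} → Trace k → Form k → Set
η ⊨ tt = ⊤
η ⊨ ff = ⊥
η ⊨ lit ℓ = ℓ ∈ head η
η ⊨ (φ ∧ ψ) = (η ⊨ φ) × (η ⊨ ψ)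
η ⊨ (φ ∨ ψ) = (η ⊨ φ) ⊎ (η ⊨ ψ)
η ⊨ X ψ = (1 < length η) × (sfx η 1 ⊨ ψ)
η ⊨ Xw ψ = (length η ≡ 1) ⊎ ((1 < length η) × (sfx η 1 ⊨ ψ))
η ⊨ (φ₁ U φ₂) =
  ∃[ i ] (i < length η) × (sfx η i ⊨ φ₂) × (∀ j → j < i → sfx η j ⊨ φ₁)
η ⊨ (φ₁ R φ₂) =
  (∀ i → i < length η → sfx η i ⊨ φ₂)
  ⊎ (∃[ i ] (i < length η) × (sfx η i ⊨ φ₁) × (∀ j → j ≤ i → sfx η j ⊨ φ₂))

_⊨ₗ_ : ∀ {k} → Letter k → Form k → Set
ω ⊨ₗ α = (ω ∷ []) ⊨ α

CF : ∀ {k} → Form k → List (Form k)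
CF (φ ∧ ψ) = CF φ ++ CF ψ
CF φ = φ ∷ []

DF : ∀ {k} → Form k → List (Form k)
DF (φ ∨ ψ) = DF φ ++ DF ψ
DF φ = φ ∷ []

-- A clause α ∧ X(ψ) is represented by the pair (α , ψ).
Clause : ℕ → Set
Clause k = Form k × Form k

conjNF : ∀ {k} → List (Clause k) → List (Clause k) → List (Clause k)
conjNF c₁ c₂ = concatMap (λ { (α₁ , ψ₁) → map (λ { (α₂ , ψ₂) → ((α₁ ∧ α₂) , (ψ₁ ∧ ψ₂)) }) c₂ }) c₁

nextNF : ∀ {k} → Form k → List (Clause k)
nextNF φ = map (λ ψ → (tt , ψ)) (DF φ)

NF : ∀ {k} → Form k → List (Clause k)
NF tt = (tt , tt) ∷ []
NF ff = []
NF (lit ℓ) = (lit ℓ , tt) ∷ []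
NF (φ₁ ∧ φ₂) = conjNF (NF φ₁) (NF φ₂)
NF (φ₁ ∨ φ₂) = NF φ₁ ++ NF φ₂
NF (X φ) = nextNF φ
NF (Xw φ) = nextNF φ
NF (φ₁ U φ₂) = NF φ₂ ++ conjNF (NF φ₁) (nextNF (φ₁ U φ₂))
NF (φ₁ R φ₂) = conjNF (NF φ₁) (NF φ₂) ++ conjNF (NF φ₂) (nextNF (φ₁ R φ₂))

litOf : ∀ {k} → Form k → List (Lit k)
litOf (lit ℓ) = ℓ ∷ []
litOf _ = []

ωOf : ∀ {k} → Form k → Letter k
ωOf α = concatMap litOf (CF α)

_─[_]→_ : ∀ {k} → Form k → Form k → Form k → Set
ψ₁ ─[ α ]→ ψ₂ = (α , ψ₂) ∈ NF ψ₁

-- A run of T_φ on η = ω₀ … ωₙ : states s₀ … s_{n+1}, labels α₀ … αₙ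
-- (given as functions on ℕ, only indices i ≤ n (resp. n+1) matter),
-- with s₀ = φ, sᵢ --αᵢ--> sᵢ₊₁ and ωᵢ ⊨ αᵢ for all 0 ≤ i ≤ n.
IsRun : ∀ {k} → Form k → Trace k → (ℕ → Form k) → (ℕ → Form k) → Set
IsRun φ η s a =
  (s 0 ≡ φ) ×
  (∀ i → i < length η → (s i ─[ a i ]→ s (suc i)) × (head (sfx η i) ⊨ₗ a i))

-- NF φ unfolds φ by one step: a clause α ∧ X ψ splits a trace into its first letter, which must
-- satisfy α, and the rest, which must satisfy ψ; U and R are unfolded by the expansion laws
-- φ₁ U φ₂ ≡ φ₂ ∨ (φ₁ ∧ X (φ₁ U φ₂)) and φ₁ R φ₂ ≡ (φ₁ ∧ φ₂) ∨ (φ₂ ∧ X (φ₁ R φ₂)). Induction on φ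
-- gives part 2. On a length-one trace X is false, Xw is true and U, R reduce to their right
-- argument, so satisfaction by a letter is monotone in the letter and a label α is satisfied by
-- its least model ωOf α; this gives part 1. Part 3 iterates part 2 along the trace and closes
-- with part 1 at the last letter.
module Submission where

open import Defs
open import Data.Nat using (ℕ; _<_; _≤_; zero; suc; z≤n; s≤s)
open import Data.List using (List; []; _∷_; _++_; map; cartesianProductWith)
open import Data.List.NonEmpty using (_∷_; head; length)
open import Data.List.Membership.Propositional using (_∈_)
open import Data.List.Membership.Propositional.Properties
  using (∈-map⁺; ∈-map⁻; ∈-++⁺ˡ; ∈-++⁺ʳ; ∈-++⁻; ∈-cartesianProductWith⁺; ∈-cartesianProductWith⁻)
open import Data.List.Relation.Binary.Subset.Propositional using (_⊆_)
open import Data.List.Relation.Binary.Subset.Propositional.Properties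
  using (xs⊆xs++ys; xs⊆ys++xs)
open import Data.List.Relation.Unary.Any using (here)
open import Data.List.Properties using (concatMap-++)
open import Data.Product using (_×_; _,_; ∃-syntax)
open import Data.Sum using (_⊎_; inj₁; inj₂)
open import Data.Unit using (⊤) renaming (tt to ∗)
open import Data.Empty using (⊥)
open import Function.Bundles using (_⇔_; mk⇔; Equivalence)
open import Relation.Binary.PropositionalEquality using (_≡_; refl; sym; cong; subst)

private
  variable
    k : ℕ

_∧ᶜ_ : Clause k → Clause k → Clause k
(α₁ , ψ₁) ∧ᶜ (α₂ , ψ₂) = (α₁ ∧ α₂) , (ψ₁ ∧ ψ₂)

conjNF≡cartesianProductWith : (c₁ c₂ : List (Clause k)) →
  conjNF c₁ c₂ ≡ cartesianProductWith _∧ᶜ_ c₁ c₂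
conjNF≡cartesianProductWith []       c₂ = refl
conjNF≡cartesianProductWith (c ∷ c₁) c₂ =
  cong (map (c ∧ᶜ_) c₂ ++_) (conjNF≡cartesianProductWith c₁ c₂)

∈-conjNF⁺ : (c₁ c₂ : List (Clause k)) {α₁ ψ₁ α₂ ψ₂ : Form k} →
  (α₁ , ψ₁) ∈ c₁ → (α₂ , ψ₂) ∈ c₂ → ((α₁ ∧ α₂) , (ψ₁ ∧ ψ₂)) ∈ conjNF c₁ c₂
∈-conjNF⁺ c₁ c₂ m₁ m₂ =
  subst (_ ∈_) (sym (conjNF≡cartesianProductWith c₁ c₂)) (∈-cartesianProductWith⁺ _∧ᶜ_ m₁ m₂)

∈-conjNF⁻ : (c₁ c₂ : List (Clause k)) {α ψ : Form k} → (α , ψ) ∈ conjNF c₁ c₂ →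
  ∃[ α₁ ] ∃[ ψ₁ ] ∃[ α₂ ] ∃[ ψ₂ ]
    ((α₁ , ψ₁) ∈ c₁) × ((α₂ , ψ₂) ∈ c₂) × (α ≡ (α₁ ∧ α₂)) × (ψ ≡ (ψ₁ ∧ ψ₂))
∈-conjNF⁻ c₁ c₂ m
  with ∈-cartesianProductWith⁻ _∧ᶜ_ c₁ c₂ (subst (_ ∈_) (conjNF≡cartesianProductWith c₁ c₂) m)
... | (α₁ , ψ₁) , (α₂ , ψ₂) , m₁ , m₂ , refl = α₁ , ψ₁ , α₂ , ψ₂ , m₁ , m₂ , refl , refl

∈-nextNF⁺ : (φ : Form k) {ψ : Form k} → ψ ∈ DF φ → (tt , ψ) ∈ nextNF φ
∈-nextNF⁺ φ = ∈-map⁺ _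

∈-nextNF⁻ : (φ : Form k) {α ψ : Form k} → (α , ψ) ∈ nextNF φ → (α ≡ tt) × (ψ ∈ DF φ)
∈-nextNF⁻ φ m with ∈-map⁻ _ m
... | _ , m′ , refl = refl , m′

∈-NF-U-step : (φ₁ φ₂ : Form k) {α ψ : Form k} → (α , ψ) ∈ NF φ₁ →
  ((α ∧ tt) , (ψ ∧ (φ₁ U φ₂))) ∈ NF (φ₁ U φ₂)
∈-NF-U-step φ₁ φ₂ m = ∈-++⁺ʳ (NF φ₂) (∈-conjNF⁺ (NF φ₁) (nextNF (φ₁ U φ₂)) m (here refl))

∈-NF-R-step : (φ₁ φ₂ : Form k) {α ψ : Form k} → (α , ψ) ∈ NF φ₂ →
  ((α ∧ tt) , (ψ ∧ (φ₁ R φ₂))) ∈ NF (φ₁ R φ₂)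
∈-NF-R-step φ₁ φ₂ m =
  ∈-++⁺ʳ (conjNF (NF φ₁) (NF φ₂)) (∈-conjNF⁺ (NF φ₂) (nextNF (φ₁ R φ₂)) m (here refl))

∃-NF-clause : Form k → (Form k → Form k → Set) → Set
∃-NF-clause φ P = ∃[ α ] ∃[ ψ ] ((α , ψ) ∈ NF φ) × P α ψ

DF-nonempty : (φ : Form k) → ∃[ ψ ] ψ ∈ DF φ
DF-nonempty (φ ∨ _) with DF-nonempty φ
... | ψ , m = ψ , ∈-++⁺ˡ m
DF-nonempty tt       = _ , here refl
DF-nonempty ff       = _ , here refl
DF-nonempty (lit _)  = _ , here refl
DF-nonempty (_ ∧ _)  = _ , here refl
DF-nonempty (X _)    = _ , here refl
DF-nonempty (Xw _)   = _ , here refl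
DF-nonempty (_ U _)  = _ , here refl
DF-nonempty (_ R _)  = _ , here refl

⊨-DF⁺ : (η : Trace k) (φ : Form k) → η ⊨ φ → ∃[ ψ ] (ψ ∈ DF φ) × (η ⊨ ψ)
⊨-DF⁺ η (φ₁ ∨ φ₂) (inj₁ h) with ⊨-DF⁺ η φ₁ h
... | ψ , m , h′ = ψ , ∈-++⁺ˡ m , h′
⊨-DF⁺ η (φ₁ ∨ φ₂) (inj₂ h) with ⊨-DF⁺ η φ₂ h
... | ψ , m , h′ = ψ , ∈-++⁺ʳ (DF φ₁) m , h′
⊨-DF⁺ η tt       h = _ , here refl , h
⊨-DF⁺ η (lit _)  h = _ , here refl , h
⊨-DF⁺ η (_ ∧ _)  h = _ , here refl , h
⊨-DF⁺ η (X _)    h = _ , here refl , h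
⊨-DF⁺ η (Xw _)   h = _ , here refl , h
⊨-DF⁺ η (_ U _)  h = _ , here refl , h
⊨-DF⁺ η (_ R _)  h = _ , here refl , h

⊨-DF⁻ : (η : Trace k) (φ : Form k) {ψ : Form k} → ψ ∈ DF φ → η ⊨ ψ → η ⊨ φ
⊨-DF⁻ η (φ₁ ∨ φ₂) m h with ∈-++⁻ (DF φ₁) m
... | inj₁ m′ = inj₁ (⊨-DF⁻ η φ₁ m′ h)
... | inj₂ m′ = inj₂ (⊨-DF⁻ η φ₂ m′ h)
⊨-DF⁻ η tt       (here refl) h = h
⊨-DF⁻ η ff       (here refl) h = h
⊨-DF⁻ η (lit _)  (here refl) h = h
⊨-DF⁻ η (_ ∧ _)  (here refl) h = h
⊨-DF⁻ η (X _)    (here refl) h = h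
⊨-DF⁻ η (Xw _)   (here refl) h = h
⊨-DF⁻ η (_ U _)  (here refl) h = h
⊨-DF⁻ η (_ R _)  (here refl) h = h

_⊨₁_ : Letter k → Form k → Set
ω ⊨₁ tt      = ⊤
ω ⊨₁ ff      = ⊥
ω ⊨₁ lit ℓ   = ℓ ∈ ω
ω ⊨₁ (φ ∧ ψ) = (ω ⊨₁ φ) × (ω ⊨₁ ψ)
ω ⊨₁ (φ ∨ ψ) = (ω ⊨₁ φ) ⊎ (ω ⊨₁ ψ)
ω ⊨₁ X _     = ⊥
ω ⊨₁ Xw _    = ⊤
ω ⊨₁ (_ U ψ) = ω ⊨₁ ψ
ω ⊨₁ (_ R ψ) = ω ⊨₁ ψ

⊨ₗ⇒⊨₁ : (ω : Letter k) (φ : Form k) → ω ⊨ₗ φ → ω ⊨₁ φ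
⊨ₗ⇒⊨₁ ω tt      h = ∗
⊨ₗ⇒⊨₁ ω (lit _) h = h
⊨ₗ⇒⊨₁ ω (φ ∧ ψ) (h₁ , h₂) = ⊨ₗ⇒⊨₁ ω φ h₁ , ⊨ₗ⇒⊨₁ ω ψ h₂
⊨ₗ⇒⊨₁ ω (φ ∨ ψ) (inj₁ h) = inj₁ (⊨ₗ⇒⊨₁ ω φ h)
⊨ₗ⇒⊨₁ ω (φ ∨ ψ) (inj₂ h) = inj₂ (⊨ₗ⇒⊨₁ ω ψ h)
⊨ₗ⇒⊨₁ ω (X _)   (s≤s () , _)
⊨ₗ⇒⊨₁ ω (Xw _)  h = ∗
⊨ₗ⇒⊨₁ ω (_ U ψ) (zero , _ , h , _) = ⊨ₗ⇒⊨₁ ω ψ h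
⊨ₗ⇒⊨₁ ω (_ U ψ) (suc _ , s≤s () , _)
⊨ₗ⇒⊨₁ ω (_ R ψ) (inj₁ always) = ⊨ₗ⇒⊨₁ ω ψ (always 0 (s≤s z≤n))
⊨ₗ⇒⊨₁ ω (_ R ψ) (inj₂ (zero , _ , _ , upto)) = ⊨ₗ⇒⊨₁ ω ψ (upto 0 z≤n)
⊨ₗ⇒⊨₁ ω (_ R ψ) (inj₂ (suc _ , s≤s () , _))

⊨₁⇒⊨ₗ : (ω : Letter k) (φ : Form k) → ω ⊨₁ φ → ω ⊨ₗ φ
⊨₁⇒⊨ₗ ω tt      h = ∗
⊨₁⇒⊨ₗ ω (lit _) h = h
⊨₁⇒⊨ₗ ω (φ ∧ ψ) (h₁ , h₂) = ⊨₁⇒⊨ₗ ω φ h₁ , ⊨₁⇒⊨ₗ ω ψ h₂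
⊨₁⇒⊨ₗ ω (φ ∨ ψ) (inj₁ h) = inj₁ (⊨₁⇒⊨ₗ ω φ h)
⊨₁⇒⊨ₗ ω (φ ∨ ψ) (inj₂ h) = inj₂ (⊨₁⇒⊨ₗ ω ψ h)
⊨₁⇒⊨ₗ ω (Xw _)  h = inj₁ refl
⊨₁⇒⊨ₗ ω (_ U ψ) h = zero , s≤s z≤n , ⊨₁⇒⊨ₗ ω ψ h , λ _ ()
⊨₁⇒⊨ₗ ω (_ R ψ) h = inj₁ λ { zero _ → ⊨₁⇒⊨ₗ ω ψ h ; (suc _) (s≤s ()) }

⊨₁-mono : {ω ω′ : Letter k} → ω ⊆ ω′ → (φ : Form k) → ω ⊨₁ φ → ω′ ⊨₁ φ
⊨₁-mono ω⊆ω′ tt      h = h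
⊨₁-mono ω⊆ω′ (lit _) h = ω⊆ω′ h
⊨₁-mono ω⊆ω′ (φ ∧ ψ) (h₁ , h₂) = ⊨₁-mono ω⊆ω′ φ h₁ , ⊨₁-mono ω⊆ω′ ψ h₂
⊨₁-mono ω⊆ω′ (φ ∨ ψ) (inj₁ h) = inj₁ (⊨₁-mono ω⊆ω′ φ h)
⊨₁-mono ω⊆ω′ (φ ∨ ψ) (inj₂ h) = inj₂ (⊨₁-mono ω⊆ω′ ψ h)
⊨₁-mono ω⊆ω′ (Xw _)  h = h
⊨₁-mono ω⊆ω′ (_ U ψ) h = ⊨₁-mono ω⊆ω′ ψ h
⊨₁-mono ω⊆ω′ (_ R ψ) h = ⊨₁-mono ω⊆ω′ ψ h

ωOf-∧ : (α β : Form k) → ωOf (α ∧ β) ≡ ωOf α ++ ωOf β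
ωOf-∧ α β = concatMap-++ litOf (CF α) (CF β)

ωOf-∧-⊆ˡ : (α β : Form k) → ωOf α ⊆ ωOf (α ∧ β)
ωOf-∧-⊆ˡ α β m = subst (_ ∈_) (sym (ωOf-∧ α β)) (xs⊆xs++ys (ωOf α) (ωOf β) m)

ωOf-∧-⊆ʳ : (α β : Form k) → ωOf β ⊆ ωOf (α ∧ β)
ωOf-∧-⊆ʳ α β m = subst (_ ∈_) (sym (ωOf-∧ α β)) (xs⊆ys++xs (ωOf β) (ωOf α) m)

⊨₁⇒ωOf-⊆ : (ω : Letter k) (α : Form k) → ω ⊨₁ α → ωOf α ⊆ ω
⊨₁⇒ωOf-⊆ ω (lit _) h (here refl) = h
⊨₁⇒ωOf-⊆ ω (α ∧ β) (h₁ , h₂) m with ∈-++⁻ (ωOf α) (subst (_ ∈_) (ωOf-∧ α β) m)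
... | inj₁ m′ = ⊨₁⇒ωOf-⊆ ω α h₁ m′
... | inj₂ m′ = ⊨₁⇒ωOf-⊆ ω β h₂ m′

⊨₁⇒NF-clause : (ω : Letter k) (φ : Form k) → ω ⊨₁ φ →
  ∃-NF-clause φ λ α _ → (ω ⊨₁ α) × (ωOf α ⊨₁ φ)
⊨₁⇒NF-clause ω tt      h = tt , tt , here refl , ∗ , ∗
⊨₁⇒NF-clause ω (lit ℓ) h = lit ℓ , tt , here refl , h , here refl
⊨₁⇒NF-clause ω (φ₁ ∧ φ₂) (h₁ , h₂) with ⊨₁⇒NF-clause ω φ₁ h₁ | ⊨₁⇒NF-clause ω φ₂ h₂
... | α₁ , ψ₁ , m₁ , s₁ , t₁ | α₂ , ψ₂ , m₂ , s₂ , t₂ =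
  (α₁ ∧ α₂) , (ψ₁ ∧ ψ₂) , ∈-conjNF⁺ (NF φ₁) (NF φ₂) m₁ m₂ , (s₁ , s₂) ,
  (⊨₁-mono (ωOf-∧-⊆ˡ α₁ α₂) φ₁ t₁ , ⊨₁-mono (ωOf-∧-⊆ʳ α₁ α₂) φ₂ t₂)
⊨₁⇒NF-clause ω (φ₁ ∨ φ₂) (inj₁ h) with ⊨₁⇒NF-clause ω φ₁ h
... | α , ψ , m , s , t = α , ψ , ∈-++⁺ˡ m , s , inj₁ t
⊨₁⇒NF-clause ω (φ₁ ∨ φ₂) (inj₂ h) with ⊨₁⇒NF-clause ω φ₂ h
... | α , ψ , m , s , t = α , ψ , ∈-++⁺ʳ (NF φ₁) m , s , inj₂ t
⊨₁⇒NF-clause ω (Xw φ) h with DF-nonempty φ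
... | ψ , m = tt , ψ , ∈-nextNF⁺ φ m , ∗ , ∗
⊨₁⇒NF-clause ω (φ₁ U φ₂) h with ⊨₁⇒NF-clause ω φ₂ h
... | α , ψ , m , s , t = α , ψ , ∈-++⁺ˡ m , s , t
⊨₁⇒NF-clause ω (φ₁ R φ₂) h with ⊨₁⇒NF-clause ω φ₂ h
... | α , ψ , m , s , t =
  (α ∧ tt) , (ψ ∧ (φ₁ R φ₂)) , ∈-NF-R-step φ₁ φ₂ m , (s , ∗) , ⊨₁-mono (ωOf-∧-⊆ˡ α tt) φ₂ t

NF-length-one : (φ : Form k) (η : Trace k) → length η ≡ 1 →
  (η ⊨ φ) ⇔ ∃-NF-clause φ λ α _ → (head η ⊨ₗ α) × (ωOf α ⊨ₗ φ)
NF-length-one φ (ω ∷ []) _ = mk⇔ to from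
  where
  to : ω ⊨ₗ φ → ∃-NF-clause φ λ α _ → (ω ⊨ₗ α) × (ωOf α ⊨ₗ φ)
  to h with ⊨₁⇒NF-clause ω φ (⊨ₗ⇒⊨₁ ω φ h)
  ... | α , ψ , m , s , t = α , ψ , m , ⊨₁⇒⊨ₗ ω α s , ⊨₁⇒⊨ₗ (ωOf α) φ t
  from : ∃-NF-clause φ (λ α _ → (ω ⊨ₗ α) × (ωOf α ⊨ₗ φ)) → ω ⊨ₗ φ
  from (α , _ , _ , s , t) =
    ⊨₁⇒⊨ₗ ω φ (⊨₁-mono (⊨₁⇒ωOf-⊆ ω α (⊨ₗ⇒⊨₁ ω α s)) φ (⊨ₗ⇒⊨₁ (ωOf α) φ t))
NF-length-one φ (_ ∷ _ ∷ _) ()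

⊨⇒NF-clause : (φ : Form k) (x y : Letter k) (ys : List (Letter k)) → (x ∷ y ∷ ys) ⊨ φ →
  ∃-NF-clause φ λ α ψ → (x ⊨ₗ α) × ((y ∷ ys) ⊨ ψ)
⊨⇒NF-clause tt      x y ys h = tt , tt , here refl , ∗ , ∗
⊨⇒NF-clause (lit ℓ) x y ys h = lit ℓ , tt , here refl , h , ∗
⊨⇒NF-clause (φ₁ ∧ φ₂) x y ys (h₁ , h₂) with ⊨⇒NF-clause φ₁ x y ys h₁ | ⊨⇒NF-clause φ₂ x y ys h₂
... | α₁ , ψ₁ , m₁ , s₁ , t₁ | α₂ , ψ₂ , m₂ , s₂ , t₂ =
  (α₁ ∧ α₂) , (ψ₁ ∧ ψ₂) , ∈-conjNF⁺ (NF φ₁) (NF φ₂) m₁ m₂ , (s₁ , s₂) , (t₁ , t₂)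
⊨⇒NF-clause (φ₁ ∨ φ₂) x y ys (inj₁ h) with ⊨⇒NF-clause φ₁ x y ys h
... | α , ψ , m , s , t = α , ψ , ∈-++⁺ˡ m , s , t
⊨⇒NF-clause (φ₁ ∨ φ₂) x y ys (inj₂ h) with ⊨⇒NF-clause φ₂ x y ys h
... | α , ψ , m , s , t = α , ψ , ∈-++⁺ʳ (NF φ₁) m , s , t
⊨⇒NF-clause (X φ) x y ys (_ , h) with ⊨-DF⁺ (y ∷ ys) φ h
... | ψ , m , h′ = tt , ψ , ∈-nextNF⁺ φ m , ∗ , h′
⊨⇒NF-clause (Xw φ) x y ys (inj₂ (_ , h)) with ⊨-DF⁺ (y ∷ ys) φ h
... | ψ , m , h′ = tt , ψ , ∈-nextNF⁺ φ m , ∗ , h′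
⊨⇒NF-clause (φ₁ U φ₂) x y ys (zero , _ , h₂ , _) with ⊨⇒NF-clause φ₂ x y ys h₂
... | α , ψ , m , s , t = α , ψ , ∈-++⁺ˡ m , s , t
⊨⇒NF-clause (φ₁ U φ₂) x y ys (suc i , s≤s i<n , h₂ , before)
  with ⊨⇒NF-clause φ₁ x y ys (before 0 (s≤s z≤n))
... | α , ψ , m , s , t =
  (α ∧ tt) , (ψ ∧ (φ₁ U φ₂)) , ∈-NF-U-step φ₁ φ₂ m , (s , ∗) ,
  (t , (i , i<n , h₂ , λ j j<i → before (suc j) (s≤s j<i)))
⊨⇒NF-clause (φ₁ R φ₂) x y ys (inj₁ always)
  with ⊨⇒NF-clause φ₂ x y ys (always 0 (s≤s z≤n))
... | α , ψ , m , s , t =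
  (α ∧ tt) , (ψ ∧ (φ₁ R φ₂)) , ∈-NF-R-step φ₁ φ₂ m , (s , ∗) ,
  (t , inj₁ λ i i<n → always (suc i) (s≤s i<n))
⊨⇒NF-clause (φ₁ R φ₂) x y ys (inj₂ (zero , _ , h₁ , upto))
  with ⊨⇒NF-clause φ₁ x y ys h₁ | ⊨⇒NF-clause φ₂ x y ys (upto 0 z≤n)
... | α₁ , ψ₁ , m₁ , s₁ , t₁ | α₂ , ψ₂ , m₂ , s₂ , t₂ =
  (α₁ ∧ α₂) , (ψ₁ ∧ ψ₂) , ∈-++⁺ˡ (∈-conjNF⁺ (NF φ₁) (NF φ₂) m₁ m₂) , (s₁ , s₂) , (t₁ , t₂)
⊨⇒NF-clause (φ₁ R φ₂) x y ys (inj₂ (suc i , s≤s i<n , h₁ , upto))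
  with ⊨⇒NF-clause φ₂ x y ys (upto 0 z≤n)
... | α , ψ , m , s , t =
  (α ∧ tt) , (ψ ∧ (φ₁ R φ₂)) , ∈-NF-R-step φ₁ φ₂ m , (s , ∗) ,
  (t , inj₂ (i , i<n , h₁ , λ j j≤i → upto (suc j) (s≤s j≤i)))

NF-clause⇒⊨ : (φ : Form k) (x y : Letter k) (ys : List (Letter k)) {α ψ : Form k} →
  (α , ψ) ∈ NF φ → x ⊨ₗ α → (y ∷ ys) ⊨ ψ → (x ∷ y ∷ ys) ⊨ φ
NF-clause⇒⊨ tt      x y ys (here refl) s t = ∗
NF-clause⇒⊨ (lit ℓ) x y ys (here refl) s t = s
NF-clause⇒⊨ (φ₁ ∧ φ₂) x y ys m s t with ∈-conjNF⁻ (NF φ₁) (NF φ₂) m | s | t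
... | _ , _ , _ , _ , m₁ , m₂ , refl , refl | s₁ , s₂ | t₁ , t₂ =
  NF-clause⇒⊨ φ₁ x y ys m₁ s₁ t₁ , NF-clause⇒⊨ φ₂ x y ys m₂ s₂ t₂
NF-clause⇒⊨ (φ₁ ∨ φ₂) x y ys m s t with ∈-++⁻ (NF φ₁) m
... | inj₁ m′ = inj₁ (NF-clause⇒⊨ φ₁ x y ys m′ s t)
... | inj₂ m′ = inj₂ (NF-clause⇒⊨ φ₂ x y ys m′ s t)
NF-clause⇒⊨ (X φ) x y ys m s t with ∈-nextNF⁻ φ m
... | refl , m′ = s≤s (s≤s z≤n) , ⊨-DF⁻ (y ∷ ys) φ m′ t
NF-clause⇒⊨ (Xw φ) x y ys m s t with ∈-nextNF⁻ φ m
... | refl , m′ = inj₂ (s≤s (s≤s z≤n) , ⊨-DF⁻ (y ∷ ys) φ m′ t)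
NF-clause⇒⊨ (φ₁ U φ₂) x y ys m s t with ∈-++⁻ (NF φ₂) m
... | inj₁ m′ = zero , s≤s z≤n , NF-clause⇒⊨ φ₂ x y ys m′ s t , λ _ ()
... | inj₂ m′ with ∈-conjNF⁻ (NF φ₁) (nextNF (φ₁ U φ₂)) m′ | s | t
...   | _ , _ , _ , _ , m₁ , here refl , refl , refl | s₁ , _ | t₁ , (i , i<n , h₂ , before) =
  suc i , s≤s i<n , h₂ ,
  λ { zero _ → NF-clause⇒⊨ φ₁ x y ys m₁ s₁ t₁ ; (suc j) (s≤s j<i) → before j j<i }
NF-clause⇒⊨ (φ₁ R φ₂) x y ys m s t with ∈-++⁻ (conjNF (NF φ₁) (NF φ₂)) m
... | inj₁ m′ with ∈-conjNF⁻ (NF φ₁) (NF φ₂) m′ | s | t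
...   | _ , _ , _ , _ , m₁ , m₂ , refl , refl | s₁ , s₂ | t₁ , t₂ =
  inj₂ (zero , s≤s z≤n , NF-clause⇒⊨ φ₁ x y ys m₁ s₁ t₁ ,
        λ { zero _ → NF-clause⇒⊨ φ₂ x y ys m₂ s₂ t₂ ; (suc _) () })
NF-clause⇒⊨ (φ₁ R φ₂) x y ys m s t | inj₂ m′
  with ∈-conjNF⁻ (NF φ₂) (nextNF (φ₁ R φ₂)) m′ | s | t
...   | _ , _ , _ , _ , m₂ , here refl , refl , refl | s₂ , _ | t₂ , inj₁ always =
  inj₁ λ { zero _ → NF-clause⇒⊨ φ₂ x y ys m₂ s₂ t₂ ; (suc i) (s≤s i<n) → always i i<n }
...   | _ , _ , _ , _ , m₂ , here refl , refl , refl | s₂ , _ | t₂ , inj₂ (i , i<n , h₁ , upto) =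
  inj₂ (suc i , s≤s i<n , h₁ ,
        λ { zero _ → NF-clause⇒⊨ φ₂ x y ys m₂ s₂ t₂ ; (suc j) (s≤s j≤i) → upto j j≤i })

NF-step : (φ : Form k) (η : Trace k) → 2 ≤ length η →
  (η ⊨ φ) ⇔ ∃-NF-clause φ λ α ψ → (head η ⊨ₗ α) × (sfx η 1 ⊨ ψ)
NF-step φ (x ∷ y ∷ ys) _ =
  mk⇔ (⊨⇒NF-clause φ x y ys) λ (_ , _ , m , s , t) → NF-clause⇒⊨ φ x y ys m s t
NF-step φ (_ ∷ []) (s≤s ())

SatisfyingRun : Form k → Trace k → Set
SatisfyingRun φ η = ∃[ s ] ∃[ a ] IsRun φ η s a × (∀ i → i < length η → sfx η i ⊨ s i)

SatisfyingRun-∷ : {φ α ψ : Form k} (x y : Letter k) (ys : List (Letter k)) →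
  (α , ψ) ∈ NF φ → x ⊨ₗ α → (x ∷ y ∷ ys) ⊨ φ → SatisfyingRun ψ (y ∷ ys) →
  SatisfyingRun φ (x ∷ y ∷ ys)
SatisfyingRun-∷ {φ = φ} {α} x y ys m s h (states , labels , (refl , steps) , sats) =
  (λ { zero → φ ; (suc i) → states i }) , (λ { zero → α ; (suc i) → labels i }) ,
  (refl , λ { zero _ → m , s ; (suc i) (s≤s i<n) → steps i i<n }) ,
  λ { zero _ → h ; (suc i) (s≤s i<n) → sats i i<n }

⊨⇒SatisfyingRun : (φ : Form k) (x : Letter k) (xs : List (Letter k)) →
  (x ∷ xs) ⊨ φ → SatisfyingRun φ (x ∷ xs)
⊨⇒SatisfyingRun φ x [] h with Equivalence.to (NF-length-one φ (x ∷ []) refl) h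
... | α , ψ , m , s , _ =
  (λ { zero → φ ; (suc _) → ψ }) , (λ _ → α) ,
  (refl , λ { zero _ → m , s ; (suc _) (s≤s ()) }) ,
  λ { zero _ → h ; (suc _) (s≤s ()) }
⊨⇒SatisfyingRun φ x (y ∷ ys) h with ⊨⇒NF-clause φ x y ys h
... | _ , ψ , m , s , t = SatisfyingRun-∷ x y ys m s h (⊨⇒SatisfyingRun ψ y ys t)

⊨⇔SatisfyingRun : (φ : Form k) (η : Trace k) → (η ⊨ φ) ⇔ SatisfyingRun φ η
⊨⇔SatisfyingRun φ (x ∷ xs) =
  mk⇔ (⊨⇒SatisfyingRun φ x xs) λ { (_ , _ , (refl , _) , sats) → sats 0 (s≤s z≤n) }

lemma2 : ∀ {k : ℕ} (φ : Form k) (η : Trace k) →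
    (length η ≡ 1 →
      ((η ⊨ φ) ⇔ (∃[ α ] ∃[ ψ ] ((α , ψ) ∈ NF φ) × (head η ⊨ₗ α) × (ωOf α ⊨ₗ φ))))
    × (2 ≤ length η →
      ((η ⊨ φ) ⇔ (∃[ α ] ∃[ ψ ] ((α , ψ) ∈ NF φ) × (head η ⊨ₗ α) × (sfx η 1 ⊨ ψ))))
    × ((η ⊨ φ) ⇔
      (∃[ s ] ∃[ a ] IsRun φ η s a × (∀ i → i < length η → sfx η i ⊨ s i)))
lemma2 φ η = NF-length-one φ η , NF-step φ η , ⊨⇔SatisfyingRun φ η
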